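{- Let $k$ be a commutative ring that is not the zero ring and let $d,e\in\mathbb{Z}^2$ be linearly independent nonzero vectors. Then in the group ring $k[\mathbb{Z}^2]$, the element $[d]-1$ is weakly coprime to $[e]-1$.
   Context: The group ring $k[\mathbb{Z}^2]$ is the free $k$-module with basis $\{[x]:x\in\mathbb{Z}^2\}$ and multiplication $[x][y]=[x+y]$. For a commutative ring $R$ and $f,g\in R$, $f$ is called weakly coprime to $g$ if multiplication by $f$ is an injective map on $R/(g)$. -}

module Defs where

open import Level using (Level; _⊔_)
open import Data.Product using (Σ; ∃; _×_; _,_; proj₁; proj₂)
open import Data.Product.Properties using (≡-dec)
open import Data.List using (List; []; _∷_; [_]; _++_; map; concatMap)
open import Data.Integer as ℤ using (ℤ)
import Data.Integer.Properties as ℤP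
open import Relation.Nullary using (¬_; yes; no)
open import Relation.Binary.PropositionalEquality using (_≡_)
open import Algebra.Bundles using (CommutativeRing)
open import Algebra.Bundles.Raw using (RawRing)

ℤ² : Set
ℤ² = ℤ × ℤ

_+²_ : ℤ² → ℤ² → ℤ²
(a , b) +² (c , d) = (a ℤ.+ c , b ℤ.+ d)

_·²_ : ℤ → ℤ² → ℤ²
n ·² (a , b) = (n ℤ.* a , n ℤ.* b)

0² : ℤ²
0² = (ℤ.0ℤ , ℤ.0ℤ)

LinearlyIndependent : ℤ² → ℤ² → Set
LinearlyIndependent d e =
  ∀ (a b : ℤ) → (a ·² d) +² (b ·² e) ≡ 0² → (a ≡ ℤ.0ℤ) × (b ≡ ℤ.0ℤ)

module _ {c ℓ : Level} (R : RawRing c ℓ) where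
  open RawRing R

  _∈⟨_⟩ : Carrier → Carrier → Set (c ⊔ ℓ)
  x ∈⟨ g ⟩ = ∃ λ q → x ≈ g * q

  WeaklyCoprime : Carrier → Carrier → Set (c ⊔ ℓ)
  WeaklyCoprime f g =
    ∀ a b → ((f * a) + (- (f * b))) ∈⟨ g ⟩ → (a + (- b)) ∈⟨ g ⟩

-- The group ring k[ℤ²]: elements are formal finite sums Σ cᵢ [xᵢ], represented
-- by lists of (coefficient, basis element); two such are equal iff every
-- basis element has the same total coefficient (free k-module on ℤ²).
module GroupRing {c ℓ : Level} (k : CommutativeRing c ℓ) where
  open CommutativeRing k renaming (Carrier to K)

  Elem : Set c
  Elem = List (K × ℤ²)

  _≟²_ = ≡-dec ℤP._≟_ ℤP._≟_

  coeff : Elem → ℤ² → K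
  coeff [] x = 0#
  coeff ((a , y) ∷ l) x with y ≟² x
  ... | yes _ = a + coeff l x
  ... | no  _ = coeff l x

  _≈ᴳ_ : Elem → Elem → Set ℓ
  f ≈ᴳ g = ∀ x → coeff f x ≈ coeff g x

  _+ᴳ_ : Elem → Elem → Elem
  f +ᴳ g = f ++ g

  -ᴳ_ : Elem → Elem
  -ᴳ f = map (λ p → (- proj₁ p , proj₂ p)) f

  -- [x][y] = [x+y], extended bilinearly
  _*ᴳ_ : Elem → Elem → Elem
  f *ᴳ g = concatMap (λ p → map (λ q → (proj₁ p * proj₁ q , proj₂ p +² proj₂ q)) g) f

  0ᴳ : Elem
  0ᴳ = []

  ⟦_⟧ : ℤ² → Elem
  ⟦ x ⟧ = [ (1# , x) ]

  1ᴳ : Elem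
  1ᴳ = ⟦ 0² ⟧

  k[ℤ²] : RawRing c ℓ
  k[ℤ²] = record
    { Carrier = Elem ; _≈_ = _≈ᴳ_ ; _+_ = _+ᴳ_ ; _*_ = _*ᴳ_
    ; -_ = -ᴳ_ ; 0# = 0ᴳ ; 1# = 1ᴳ }

  [_]-1 : ℤ² → Elem
  [ x ]-1 = ⟦ x ⟧ +ᴳ (-ᴳ 1ᴳ)

module Submission where

-- Let h = a - b with ([d] - 1)h ∈ ([e] - 1). For a decidable set P ⊆ ℤ², the mass of h on P is
-- the sum of the coefficients of h at the points of P; it is linear in h.
--  (1) mass_P(([v] - 1)T) = mass_{P - v}(T) - mass_P(T), so elements of ([e] - 1) have zero mass on
--      every e-invariant set, in particular on every coset z + ℤe.
--  (2) Criterion: if h has zero mass on every coset z + ℤe then h ∈ ([e] - 1). Modulo ([e] - 1)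
--      the terms of h in one coset collapse into a single term, whose coefficient is then the
--      coset mass 0; we induct on the number of terms.
--  (3) The case e = 0 of (2) shows that masses respect coefficientwise equality in k[ℤ²].
--  (4) By (1) and (3) the hypothesis makes the masses of h on e-invariant sets invariant under
--      translation by d. As det(e, d) ≠ 0, translating a coset z + ℤe far along d moves it off
--      the finitely many terms of h, so every coset mass of h vanishes and (2) concludes.

open import Defs
open import Level using (Level; 0ℓ; _⊔_)
open import Data.Integer as ℤ using (ℤ; +_; -[1+_]; 0ℤ; 1ℤ)
open import Data.Nat as ℕ using (ℕ; zero; suc; s≤s)
import Data.Nat.Properties as ℕP
open import Data.Product using (Σ; _,_; proj₁; proj₂)
open import Data.List using ([]; _∷_; _++_; map; length)
open import Data.List.Relation.Unary.All using (All; []; _∷_)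
open import Data.Maybe using (nothing)
open import Data.Empty using (⊥-elim)
open import Relation.Nullary using (¬_; Dec; yes; no)
open import Relation.Binary.PropositionalEquality as ≡ using (_≢_)
open import Relation.Unary using (Pred; Decidable; _≐_)
open import Algebra.Bundles using (CommutativeRing)
import Tactic.RingSolver.Core.AlmostCommutativeRing as ACR
import Tactic.RingSolver.NonReflective as RingSolver

module Lattice where
  import Data.Integer.Properties as ℤP
  open import Data.Integer.Divisibility.Signed using (divides; _∣?_)
  open import Data.Integer.Tactic.RingSolver using (solve-∀)
  open import Data.Product using (∃-syntax; swap)
  open import Data.Product.Properties using (≡-dec)
  open import Relation.Nullary.Decidable using (map′)
  open import Relation.Binary.PropositionalEquality
    using (_≡_; refl; sym; trans; cong; cong₂; subst; module ≡-Reasoning)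
  open ≡-Reasoning
  open import Algebra.Properties.AbelianGroup ℤP.+-0-abelianGroup
    using () renaming (∙-cancelˡ to +-cancelˡ)

  +²-identityˡ : ∀ y → 0² +² y ≡ y
  +²-identityˡ (y₁ , y₂) = cong₂ _,_ (lemma y₁) (lemma y₂)
    where
    lemma : ∀ a → 0ℤ ℤ.+ a ≡ a
    lemma = solve-∀

  +²-zero-multiple : ∀ z e → z +² (0ℤ ·² e) ≡ z
  +²-zero-multiple (z₁ , z₂) (e₁ , e₂) = cong₂ _,_ (lemma z₁ e₁) (lemma z₂ e₂)
    where
    lemma : ∀ a b → a ℤ.+ 0ℤ ℤ.* b ≡ a
    lemma = solve-∀

  +²-multiple-zero : ∀ z n → z +² (n ·² 0²) ≡ z
  +²-multiple-zero (z₁ , z₂) n = cong₂ _,_ (lemma z₁ n) (lemma z₂ n)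
    where
    lemma : ∀ a n → a ℤ.+ n ℤ.* 0ℤ ≡ a
    lemma = solve-∀

  +²-left-comm : ∀ u v w → u +² (v +² w) ≡ v +² (u +² w)
  +²-left-comm (u₁ , u₂) (v₁ , v₂) (w₁ , w₂) = cong₂ _,_ (lemma u₁ v₁ w₁) (lemma u₂ v₂ w₂)
    where
    lemma : ∀ a b c → a ℤ.+ (b ℤ.+ c) ≡ b ℤ.+ (a ℤ.+ c)
    lemma = solve-∀

  +²-multiple-suc : ∀ e z n → e +² (z +² (n ·² e)) ≡ z +² ((1ℤ ℤ.+ n) ·² e)
  +²-multiple-suc (e₁ , e₂) (z₁ , z₂) n = cong₂ _,_ (lemma e₁ z₁ n) (lemma e₂ z₂ n)
    where
    lemma : ∀ a b n → a ℤ.+ (b ℤ.+ n ℤ.* a) ≡ b ℤ.+ (1ℤ ℤ.+ n) ℤ.* a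
    lemma = solve-∀

  +²-multiple-pred : ∀ e z n → e +² (z +² ((n ℤ.- 1ℤ) ·² e)) ≡ z +² (n ·² e)
  +²-multiple-pred (e₁ , e₂) (z₁ , z₂) n = cong₂ _,_ (lemma e₁ z₁ n) (lemma e₂ z₂ n)
    where
    lemma : ∀ a b n → a ℤ.+ (b ℤ.+ (n ℤ.- 1ℤ) ℤ.* a) ≡ b ℤ.+ n ℤ.* a
    lemma = solve-∀

  +²-multiple-cancel : ∀ e z n → (z +² ((ℤ.- n) ·² e)) +² (n ·² e) ≡ z
  +²-multiple-cancel (e₁ , e₂) (z₁ , z₂) n = cong₂ _,_ (lemma e₁ z₁ n) (lemma e₂ z₂ n)
    where
    lemma : ∀ a b n → (b ℤ.+ (ℤ.- n) ℤ.* a) ℤ.+ n ℤ.* a ≡ b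
    lemma = solve-∀

  ·²-suc-+² : ∀ n d y → ((1ℤ ℤ.+ n) ·² d) +² y ≡ (n ·² d) +² (d +² y)
  ·²-suc-+² n (d₁ , d₂) (y₁ , y₂) = cong₂ _,_ (lemma n d₁ y₁) (lemma n d₂ y₂)
    where
    lemma : ∀ n a b → (1ℤ ℤ.+ n) ℤ.* a ℤ.+ b ≡ n ℤ.* a ℤ.+ (a ℤ.+ b)
    lemma = solve-∀

  +²-cancelˡ : ∀ e {u v} → e +² u ≡ e +² v → u ≡ v
  +²-cancelˡ (e₁ , e₂) {u₁ , u₂} {v₁ , v₂} eq =
    cong₂ _,_ (+-cancelˡ e₁ u₁ v₁ (cong proj₁ eq)) (+-cancelˡ e₂ u₂ v₂ (cong proj₂ eq))

  _≟ℤ²_ : (u v : ℤ²) → Dec (u ≡ v)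
  _≟ℤ²_ = ≡-dec ℤ._≟_ ℤ._≟_

  reindex : ∀ (P : Pred ℤ² 0ℓ) {f g : ℤ² → ℤ²} → (∀ y → f y ≡ g y) → (λ y → P (f y)) ≐ (λ y → P (g y))
  reindex P f≡g = (λ {y} → subst P (f≡g y)) , (λ {y} → subst P (sym (f≡g y)))

  Coset : ℤ² → ℤ² → Pred ℤ² 0ℓ
  Coset e z y = ∃[ n ] y ≡ z +² (n ·² e)

  Invariant : ℤ² → Pred ℤ² 0ℓ → Set
  Invariant v P = (λ y → P (v +² y)) ≐ P

  invariant-0² : ∀ P → Invariant 0² P
  invariant-0² P = reindex P +²-identityˡ

  coset-0² : ∀ z → Coset 0² z ≐ (_≡ z)
  coset-0² z = (λ (n , eq) → trans eq (+²-multiple-zero z n)) ,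
               (λ eq → 0ℤ , trans eq (sym (+²-multiple-zero z 0ℤ)))

  coset-refl : ∀ e z → Coset e z z
  coset-refl e z = 0ℤ , sym (+²-zero-multiple z e)

  coset-invariant : ∀ e z → Invariant e (Coset e z)
  coset-invariant e z = shift-down , shift-up
    where
    shift-down : ∀ {y} → Coset e z (e +² y) → Coset e z y
    shift-down (n , eq) = n ℤ.- 1ℤ , +²-cancelˡ e (trans eq (sym (+²-multiple-pred e z n)))
    shift-up : ∀ {y} → Coset e z y → Coset e z (e +² y)
    shift-up (n , eq) = 1ℤ ℤ.+ n , trans (cong (e +²_) eq) (+²-multiple-suc e z n)

  invariant-translate : ∀ {v P} u → Invariant v P → Invariant v (λ y → P (u +² y))
  invariant-translate {v} {P} u (down , up) =
    (λ p → down (proj₁ (reindex P (+²-left-comm u v)) p)) ,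
    (λ p → proj₂ (reindex P (+²-left-comm u v)) (up p))

  difference : ∀ {y} z m → y ≡ z ℤ.+ m → y ℤ.- z ≡ m
  difference z m refl = lemma z m
    where
    lemma : ∀ z m → (z ℤ.+ m) ℤ.- z ≡ m
    lemma = solve-∀

  -- For e₁ ≠ 0, the only candidate coefficient is (y₁ - z₁)/e₁, found by a divisibility test.
  coset-by-first? : ∀ {e₁} e₂ → e₁ ≢ 0ℤ → ∀ z → Decidable (Coset (e₁ , e₂) z)
  coset-by-first? {e₁} e₂ e₁≢0 (z₁ , z₂) (y₁ , y₂) with e₁ ∣? (y₁ ℤ.- z₁)
  ... | no e₁∤ = no λ (n , eq) → e₁∤ (divides n (difference z₁ _ (cong proj₁ eq)))
  ... | yes (divides q y₁-z₁≡) with (y₁ , y₂) ≟ℤ² ((z₁ , z₂) +² (q ·² (e₁ , e₂)))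
  ...   | yes eq = yes (q , eq)
  ...   | no neq = no λ (n , eq) → neq (subst (λ m → (y₁ , y₂) ≡ (z₁ , z₂) +² (m ·² (e₁ , e₂)))
                                                 (unique n (cong proj₁ eq)) eq)
    where
    unique : ∀ n → y₁ ≡ z₁ ℤ.+ n ℤ.* e₁ → n ≡ q
    unique n eq = ℤP.*-cancelʳ-≡ n q e₁ {{ℤ.≢-nonZero e₁≢0}} (trans (sym (difference z₁ _ eq)) y₁-z₁≡)

  coset? : ∀ e z → Decidable (Coset e z)
  coset? (e₁ , e₂) (z₁ , z₂) (y₁ , y₂) with e₁ ℤ.≟ 0ℤ | e₂ ℤ.≟ 0ℤ
  ... | no e₁≢0 | _ = coset-by-first? e₂ e₁≢0 (z₁ , z₂) (y₁ , y₂)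
  ... | yes refl | no e₂≢0 =
    map′ (λ (n , eq) → n , cong swap eq) (λ (n , eq) → n , cong swap eq)
         (coset-by-first? 0ℤ e₂≢0 (z₂ , z₁) (y₂ , y₁))
  ... | yes refl | yes refl =
    map′ (proj₂ (coset-0² (z₁ , z₂))) (proj₁ (coset-0² (z₁ , z₂))) ((y₁ , y₂) ≟ℤ² (z₁ , z₂))

  det : ℤ² → ℤ² → ℤ
  det (a , b) (c , d) = a ℤ.* d ℤ.- b ℤ.* c

  det-coset : ∀ e z n → det e (z +² (n ·² e)) ≡ det e z
  det-coset (e₁ , e₂) (z₁ , z₂) n = lemma e₁ e₂ z₁ z₂ n
    where
    lemma : ∀ e₁ e₂ z₁ z₂ n →
      e₁ ℤ.* (z₂ ℤ.+ n ℤ.* e₂) ℤ.- e₂ ℤ.* (z₁ ℤ.+ n ℤ.* e₁) ≡ e₁ ℤ.* z₂ ℤ.- e₂ ℤ.* z₁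
    lemma = solve-∀

  det-translate : ∀ e u y N → det e ((N ·² u) +² y) ≡ N ℤ.* det e u ℤ.+ det e y
  det-translate (e₁ , e₂) (u₁ , u₂) (y₁ , y₂) N = lemma e₁ e₂ u₁ u₂ y₁ y₂ N
    where
    lemma : ∀ e₁ e₂ u₁ u₂ y₁ y₂ N →
      e₁ ℤ.* (N ℤ.* u₂ ℤ.+ y₂) ℤ.- e₂ ℤ.* (N ℤ.* u₁ ℤ.+ y₁)
        ≡ N ℤ.* (e₁ ℤ.* u₂ ℤ.- e₂ ℤ.* u₁) ℤ.+ (e₁ ℤ.* y₂ ℤ.- e₂ ℤ.* y₁)
    lemma = solve-∀

  independent⇒det≢0 : ∀ d e → e ≢ 0² → LinearlyIndependent d e → det e d ≢ 0ℤ
  independent⇒det≢0 (d₁ , d₂) (e₁ , e₂) e≢0 independent det≡0 =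
    e≢0 (cong₂ _,_
      (proj₁ (independent e₁ (ℤ.- d₁) (cong₂ _,_ (cross e₁ d₁) (trans (first d₁ d₂ e₁ e₂) det≡0))))
      (proj₁ (independent e₂ (ℤ.- d₂) (cong₂ _,_ (trans (second d₁ d₂ e₁ e₂) (cong ℤ.-_ det≡0)) (cross e₂ d₂)))))
    where
    cross : ∀ a b → a ℤ.* b ℤ.+ (ℤ.- b) ℤ.* a ≡ 0ℤ
    cross = solve-∀
    first : ∀ d₁ d₂ e₁ e₂ → e₁ ℤ.* d₂ ℤ.+ (ℤ.- d₁) ℤ.* e₂ ≡ e₁ ℤ.* d₂ ℤ.- e₂ ℤ.* d₁
    first = solve-∀
    second : ∀ d₁ d₂ e₁ e₂ → e₂ ℤ.* d₁ ℤ.+ (ℤ.- d₂) ℤ.* e₁ ≡ ℤ.- (e₁ ℤ.* d₂ ℤ.- e₂ ℤ.* d₁)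
    second = solve-∀

  escape : ∀ e d z y N → det e d ≢ 0ℤ → ℤ.∣ det e z ℤ.- det e y ∣ ℕ.< N →
           ¬ Coset e z (((+ N) ·² d) +² y)
  escape e d z y N D≢0 small (n , eq) = ℕP.<-irrefl refl (ℕP.≤-<-trans N≤ small)
    where
    N·D≡ : + N ℤ.* det e d ≡ det e z ℤ.- det e y
    N·D≡ = sym (difference (det e y) _ (begin
      det e z                            ≡⟨ det-coset e z n ⟨
      det e (z +² (n ·² e))              ≡⟨ cong (det e) eq ⟨
      det e (((+ N) ·² d) +² y)          ≡⟨ det-translate e d y (+ N) ⟩
      + N ℤ.* det e d ℤ.+ det e y        ≡⟨ ℤP.+-comm _ (det e y) ⟩
      det e y ℤ.+ + N ℤ.* det e d        ∎))
    ∣D∣≢0 : ℤ.∣ det e d ∣ ≢ 0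
    ∣D∣≢0 p = D≢0 (ℤP.∣i∣≡0⇒i≡0 p)
    N≤ : N ℕ.≤ ℤ.∣ det e z ℤ.- det e y ∣
    N≤ = subst (N ℕ.≤_) (trans (sym (ℤP.abs-* (+ N) (det e d))) (cong ℤ.∣_∣ N·D≡))
               (ℕP.m≤m*n N ℤ.∣ det e d ∣ {{ℕ.≢-nonZero ∣D∣≢0}})

open Lattice

module GroupRingMasses {c ℓ : Level} (k : CommutativeRing c ℓ) where
  open CommutativeRing k hiding (zero) renaming (Carrier to K)
  open GroupRing k
  open import Algebra.Properties.Ring ring using (-0#≈0#; -1*x≈-x; -‿+-comm; x∙y⁻¹≈ε⇒x≈y; x≈z//y; //-rightDividesˡ)
  open import Relation.Binary.Reasoning.Setoid setoid
  open RingSolver (ACR.fromCommutativeRing k (λ _ → nothing)) using (solve; _⊜_; _⊕_; ⊝_)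

  when : {A : Set} → Dec A → K → K
  when (yes _) a = a
  when (no _) _ = 0#

  when-natural : ∀ {A} (p : Dec A) (f : K → K) → f 0# ≈ 0# → ∀ a → when p (f a) ≈ f (when p a)
  when-natural (yes _) f f0≈0 a = refl
  when-natural (no _) f f0≈0 a = sym f0≈0

  when-+ : ∀ {A} (p : Dec A) a b → when p a + when p b ≈ when p (a + b)
  when-+ (yes _) a b = refl
  when-+ (no _) a b = +-identityʳ 0#

  when-zero : ∀ {A} (p : Dec A) {a} → a ≈ 0# → when p a ≈ 0#
  when-zero (yes _) a≈0 = a≈0
  when-zero (no _) a≈0 = refl

  when-yes : ∀ {A} (p : Dec A) a → A → when p a ≈ a
  when-yes (yes _) a _ = refl
  when-yes (no ¬A) a x = ⊥-elim (¬A x)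

  when-no : ∀ {A} (p : Dec A) a → ¬ A → when p a ≈ 0#
  when-no (yes x) a ¬A = ⊥-elim (¬A x)
  when-no (no _) a ¬A = refl

  when-equiv : ∀ {A B : Set} → (A → B) → (B → A) → ∀ (p : Dec A) (q : Dec B) a → when p a ≈ when q a
  when-equiv f g (yes x) q a = sym (when-yes q a (f x))
  when-equiv f g (no ¬x) q a = sym (when-no q a (λ y → ¬x (g y)))

  mass : {P : Pred ℤ² 0ℓ} → Decidable P → Elem → K
  mass P? [] = 0#
  mass P? ((a , y) ∷ h) = when (P? y) a + mass P? h

  coeff-as-mass : ∀ h x → coeff h x ≈ mass (_≟² x) h
  coeff-as-mass [] x = refl
  coeff-as-mass ((a , y) ∷ h) x with y ≟² x
  ... | yes _ = +-congˡ (coeff-as-mass h x)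
  ... | no _ = trans (coeff-as-mass h x) (sym (+-identityˡ _))

  mass-++ : ∀ {P} (P? : Decidable P) U V → mass P? (U ++ V) ≈ mass P? U + mass P? V
  mass-++ P? [] V = sym (+-identityˡ _)
  mass-++ P? ((a , y) ∷ U) V = trans (+-congˡ (mass-++ P? U V)) (sym (+-assoc _ _ _))

  mass-neg : ∀ {P} (P? : Decidable P) U → mass P? (-ᴳ U) ≈ - mass P? U
  mass-neg P? [] = sym -0#≈0#
  mass-neg P? ((a , y) ∷ U) = begin
    when (P? y) (- a) + mass P? (-ᴳ U) ≈⟨ +-cong (when-natural (P? y) -_ -0#≈0# a) (mass-neg P? U) ⟩
    - when (P? y) a + - mass P? U       ≈⟨ -‿+-comm _ _ ⟩
    - (when (P? y) a + mass P? U)       ∎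

  mass-difference : ∀ {P} (P? : Decidable P) U V → mass P? (U ++ -ᴳ V) ≈ mass P? U - mass P? V
  mass-difference P? U V = trans (mass-++ P? U (-ᴳ V)) (+-congˡ (mass-neg P? V))

  mass-ext : ∀ {P Q} (P? : Decidable P) (Q? : Decidable Q) → P ≐ Q → ∀ h → mass P? h ≈ mass Q? h
  mass-ext P? Q? P≐Q [] = refl
  mass-ext P? Q? P≐Q ((a , y) ∷ h) =
    +-cong (when-equiv (proj₁ P≐Q) (proj₂ P≐Q) (P? y) (Q? y) a) (mass-ext P? Q? P≐Q h)

  mass-disjoint : ∀ {P} (P? : Decidable P) h → All (λ t → ¬ P (proj₂ t)) h → mass P? h ≈ 0#
  mass-disjoint P? [] [] = refl
  mass-disjoint P? ((a , y) ∷ h) (y∉P ∷ h∉P) =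
    trans (+-cong (when-no (P? y) a y∉P) (mass-disjoint P? h h∉P)) (+-identityʳ 0#)

  scaleTranslate : K → ℤ² → Elem → Elem
  scaleTranslate c v T = map (λ t → (c * proj₁ t , v +² proj₂ t)) T

  mass-scaleTranslate : ∀ {P} (P? : Decidable P) c v T →
    mass P? (scaleTranslate c v T) ≈ c * mass (λ y → P? (v +² y)) T
  mass-scaleTranslate P? c v [] = sym (zeroʳ c)
  mass-scaleTranslate P? c v ((b , w) ∷ T) = begin
    when (P? (v +² w)) (c * b) + mass P? (scaleTranslate c v T)
      ≈⟨ +-cong (when-natural (P? (v +² w)) (c *_) (zeroʳ c) b) (mass-scaleTranslate P? c v T) ⟩
    c * when (P? (v +² w)) b + c * mass (λ y → P? (v +² y)) T
      ≈⟨ distribˡ c _ _ ⟨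
    c * (when (P? (v +² w)) b + mass (λ y → P? (v +² y)) T) ∎

  mass-boundary : ∀ {P} (P? : Decidable P) v T →
    mass P? ([ v ]-1 *ᴳ T) ≈ mass (λ y → P? (v +² y)) T - mass P? T
  mass-boundary {P} P? v T = begin
    mass P? (scaleTranslate 1# v T ++ (scaleTranslate (- 1#) 0² T ++ []))
      ≈⟨ trans (mass-++ P? (scaleTranslate 1# v T) _) (+-congˡ (mass-++ P? (scaleTranslate (- 1#) 0² T) [])) ⟩
    mass P? (scaleTranslate 1# v T) + (mass P? (scaleTranslate (- 1#) 0² T) + 0#)
      ≈⟨ +-cong (mass-scaleTranslate P? 1# v T) (+-identityʳ _) ⟩
    1# * mass (λ y → P? (v +² y)) T + mass P? (scaleTranslate (- 1#) 0² T)
      ≈⟨ +-cong (*-identityˡ _) (trans (mass-scaleTranslate P? (- 1#) 0² T) (-1*x≈-x _)) ⟩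
    mass (λ y → P? (v +² y)) T - mass (λ y → P? (0² +² y)) T
      ≈⟨ +-congˡ (-‿cong (mass-ext _ P? (invariant-0² P) T)) ⟩
    mass (λ y → P? (v +² y)) T - mass P? T ∎

  mass-boundary-invariant : ∀ {v P} (P? : Decidable P) → Invariant v P → ∀ T → mass P? ([ v ]-1 *ᴳ T) ≈ 0#
  mass-boundary-invariant {v} P? invariant T =
    trans (mass-boundary P? v T) (trans (+-congʳ (mass-ext _ P? invariant T)) (-‿inverseʳ _))

  record _≋_ (U V : Elem) : Set (Level.suc 0ℓ ⊔ ℓ) where
    constructor same-masses
    field
      same-mass : ∀ {P} (P? : Decidable P) → mass P? U ≈ mass P? V
  open _≋_ public

  merge-terms : ∀ a b y h → ((a , y) ∷ (b , y) ∷ h) ≋ ((a + b , y) ∷ h)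
  merge-terms a b y h = same-masses λ P? → trans (sym (+-assoc _ _ _)) (+-congʳ (when-+ (P? y) a b))

  swap-terms : ∀ a y b w h → ((a , y) ∷ (b , w) ∷ h) ≋ ((b , w) ∷ (a , y) ∷ h)
  swap-terms a y b w h = same-masses λ P? →
    solve 3 (λ x y z → (x ⊕ (y ⊕ z)) ⊜ (y ⊕ (x ⊕ z))) refl (when (P? y) a) (when (P? w) b) (mass P? h)

  drop-zero-term : ∀ {a} y h → a ≈ 0# → ((a , y) ∷ h) ≋ h
  drop-zero-term y h a≈0 = same-masses λ P? → trans (+-congʳ (when-zero (P? y) a≈0)) (+-identityˡ _)

  outside : {Q : Pred ℤ² 0ℓ} → Decidable Q → Elem → Elem
  outside Q? [] = []
  outside Q? ((a , y) ∷ h) with Q? y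
  ... | yes _ = outside Q? h
  ... | no _ = (a , y) ∷ outside Q? h

  outside-∉ : ∀ {Q} (Q? : Decidable Q) h → All (λ t → ¬ Q (proj₂ t)) (outside Q? h)
  outside-∉ Q? [] = []
  outside-∉ Q? ((a , y) ∷ h) with Q? y
  ... | yes _ = outside-∉ Q? h
  ... | no y∉Q = y∉Q ∷ outside-∉ Q? h

  outside-length : ∀ {Q} (Q? : Decidable Q) h → length (outside Q? h) ℕ.≤ length h
  outside-length Q? [] = ℕ.z≤n
  outside-length Q? ((a , y) ∷ h) with Q? y
  ... | yes _ = ℕP.m≤n⇒m≤1+n (outside-length Q? h)
  ... | no _ = s≤s (outside-length Q? h)

  outside-shorter : ∀ {Q} (Q? : Decidable Q) a y h → Q y → length (outside Q? ((a , y) ∷ h)) ℕ.≤ length h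
  outside-shorter Q? a y h y∈Q with Q? y
  ... | yes _ = outside-length Q? h
  ... | no y∉Q = ⊥-elim (y∉Q y∈Q)

  -- Congruence modulo the ideal ([e] - 1), witnessed by a cofactor Q and tested on all masses:
  -- h ∼ h' means h = h' + ([e]-1)Q up to ≋.
  module Boundaries (e : ℤ²) where

    infix 4 _∼_
    record _∼_ (h h' : Elem) : Set (c ⊔ Level.suc 0ℓ ⊔ ℓ) where
      constructor congruent
      field
        cofactor : Elem
        masses : ∀ {P} (P? : Decidable P) →
          mass P? h ≈ mass P? h' + mass P? ([ e ]-1 *ᴳ cofactor)

    boundary-++ : ∀ {P} (P? : Decidable P) Q₁ Q₂ →
      mass P? ([ e ]-1 *ᴳ (Q₁ ++ Q₂)) ≈ mass P? ([ e ]-1 *ᴳ Q₁) + mass P? ([ e ]-1 *ᴳ Q₂)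
    boundary-++ {P} P? Q₁ Q₂ = begin
      mass P? ([ e ]-1 *ᴳ (Q₁ ++ Q₂))
        ≈⟨ mass-boundary P? e (Q₁ ++ Q₂) ⟩
      mass P?ₑ (Q₁ ++ Q₂) - mass P? (Q₁ ++ Q₂)
        ≈⟨ +-cong (mass-++ P?ₑ Q₁ Q₂) (-‿cong (mass-++ P? Q₁ Q₂)) ⟩
      (mass P?ₑ Q₁ + mass P?ₑ Q₂) - (mass P? Q₁ + mass P? Q₂)
        ≈⟨ solve 4 (λ a b c d → ((a ⊕ b) ⊕ (⊝ (c ⊕ d))) ⊜ ((a ⊕ (⊝ c)) ⊕ (b ⊕ (⊝ d)))) refl _ _ _ _ ⟩
      (mass P?ₑ Q₁ - mass P? Q₁) + (mass P?ₑ Q₂ - mass P? Q₂)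
        ≈⟨ +-cong (mass-boundary P? e Q₁) (mass-boundary P? e Q₂) ⟨
      mass P? ([ e ]-1 *ᴳ Q₁) + mass P? ([ e ]-1 *ᴳ Q₂) ∎
      where
      P?ₑ : Decidable (λ y → P (e +² y))
      P?ₑ y = P? (e +² y)

    boundary-neg : ∀ {P} (P? : Decidable P) Q →
      mass P? ([ e ]-1 *ᴳ (-ᴳ Q)) ≈ - mass P? ([ e ]-1 *ᴳ Q)
    boundary-neg {P} P? Q = begin
      mass P? ([ e ]-1 *ᴳ (-ᴳ Q))             ≈⟨ mass-boundary P? e (-ᴳ Q) ⟩
      mass P?ₑ (-ᴳ Q) - mass P? (-ᴳ Q)         ≈⟨ +-cong (mass-neg P?ₑ Q) (-‿cong (mass-neg P? Q)) ⟩
      - mass P?ₑ Q - - mass P? Q               ≈⟨ -‿+-comm _ _ ⟩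
      - (mass P?ₑ Q - mass P? Q)               ≈⟨ -‿cong (mass-boundary P? e Q) ⟨
      - mass P? ([ e ]-1 *ᴳ Q)                 ∎
      where
      P?ₑ : Decidable (λ y → P (e +² y))
      P?ₑ y = P? (e +² y)

    ≋⇒∼ : ∀ {h h'} → h ≋ h' → h ∼ h'
    ≋⇒∼ h≋h' = congruent [] λ P? → trans (same-mass h≋h' P?) (sym (+-identityʳ _))

    ∼-refl : ∀ {h} → h ∼ h
    ∼-refl = ≋⇒∼ (same-masses λ P? → refl)

    ∼-sym : ∀ {h h'} → h ∼ h' → h' ∼ h
    ∼-sym {h} {h'} (congruent Q h∼h') = congruent (-ᴳ Q) λ P? → begin
      mass P? h'                                ≈⟨ x≈z//y _ _ _ (sym (h∼h' P?)) ⟩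
      mass P? h - mass P? ([ e ]-1 *ᴳ Q)        ≈⟨ +-congˡ (boundary-neg P? Q) ⟨
      mass P? h + mass P? ([ e ]-1 *ᴳ (-ᴳ Q))   ∎

    ∼-trans : ∀ {h₁ h₂ h₃} → h₁ ∼ h₂ → h₂ ∼ h₃ → h₁ ∼ h₃
    ∼-trans {h₁} {h₂} {h₃} (congruent Q₁ h₁∼h₂) (congruent Q₂ h₂∼h₃) = congruent (Q₁ ++ Q₂) λ P? → begin
      mass P? h₁                                       ≈⟨ h₁∼h₂ P? ⟩
      mass P? h₂ + mass P? ([ e ]-1 *ᴳ Q₁)             ≈⟨ +-congʳ (h₂∼h₃ P?) ⟩
      (mass P? h₃ + mass P? ([ e ]-1 *ᴳ Q₂)) + mass P? ([ e ]-1 *ᴳ Q₁)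
        ≈⟨ solve 3 (λ x b₂ b₁ → ((x ⊕ b₂) ⊕ b₁) ⊜ (x ⊕ (b₁ ⊕ b₂))) refl _ _ _ ⟩
      mass P? h₃ + (mass P? ([ e ]-1 *ᴳ Q₁) + mass P? ([ e ]-1 *ᴳ Q₂))
        ≈⟨ +-congˡ (boundary-++ P? Q₁ Q₂) ⟨
      mass P? h₃ + mass P? ([ e ]-1 *ᴳ (Q₁ ++ Q₂))     ∎

    ∼-++ : ∀ {h₁ h₁' h₂ h₂'} → h₁ ∼ h₁' → h₂ ∼ h₂' → (h₁ ++ h₂) ∼ (h₁' ++ h₂')
    ∼-++ {h₁} {h₁'} {h₂} {h₂'} (congruent Q₁ h₁∼h₁') (congruent Q₂ h₂∼h₂') = congruent (Q₁ ++ Q₂) λ P? → begin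
      mass P? (h₁ ++ h₂)                               ≈⟨ mass-++ P? h₁ h₂ ⟩
      mass P? h₁ + mass P? h₂                          ≈⟨ +-cong (h₁∼h₁' P?) (h₂∼h₂' P?) ⟩
      (mass P? h₁' + mass P? ([ e ]-1 *ᴳ Q₁)) + (mass P? h₂' + mass P? ([ e ]-1 *ᴳ Q₂))
        ≈⟨ solve 4 (λ x b y c → ((x ⊕ b) ⊕ (y ⊕ c)) ⊜ ((x ⊕ y) ⊕ (b ⊕ c))) refl _ _ _ _ ⟩
      (mass P? h₁' + mass P? h₂') + (mass P? ([ e ]-1 *ᴳ Q₁) + mass P? ([ e ]-1 *ᴳ Q₂))
        ≈⟨ +-cong (mass-++ P? h₁' h₂') (boundary-++ P? Q₁ Q₂) ⟨
      mass P? (h₁' ++ h₂') + mass P? ([ e ]-1 *ᴳ (Q₁ ++ Q₂)) ∎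

    ∼-invariant : ∀ {P} (P? : Decidable P) → Invariant e P → ∀ {h h'} → h ∼ h' → mass P? h ≈ mass P? h'
    ∼-invariant P? invariant (congruent Q h∼h') =
      trans (h∼h' P?) (trans (+-congˡ (mass-boundary-invariant {e} P? invariant Q)) (+-identityʳ _))

    ∼⇒divisible : ∀ {h} → h ∼ [] → Σ Elem λ Q → h ≈ᴳ ([ e ]-1 *ᴳ Q)
    ∼⇒divisible {h} (congruent Q h∼[]) = Q , λ x → begin
      coeff h x                          ≈⟨ coeff-as-mass h x ⟩
      mass (_≟² x) h                     ≈⟨ h∼[] (_≟² x) ⟩
      0# + mass (_≟² x) ([ e ]-1 *ᴳ Q)   ≈⟨ +-identityˡ _ ⟩
      mass (_≟² x) ([ e ]-1 *ᴳ Q)        ≈⟨ coeff-as-mass ([ e ]-1 *ᴳ Q) x ⟨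
      coeff ([ e ]-1 *ᴳ Q) x             ∎

    ∼-step : ∀ a y → ((a , e +² y) ∷ []) ∼ ((a , y) ∷ [])
    ∼-step a y = congruent ((a , y) ∷ []) λ P? → begin
      mass (λ w → P? (e +² w)) ((a , y) ∷ [])
        ≈⟨ //-rightDividesˡ (mass P? ((a , y) ∷ [])) _ ⟨
      (mass (λ w → P? (e +² w)) ((a , y) ∷ []) - mass P? ((a , y) ∷ [])) + mass P? ((a , y) ∷ [])
        ≈⟨ +-comm _ _ ⟩
      mass P? ((a , y) ∷ []) + (mass (λ w → P? (e +² w)) ((a , y) ∷ []) - mass P? ((a , y) ∷ []))
        ≈⟨ +-congˡ (mass-boundary P? e ((a , y) ∷ [])) ⟨
      mass P? ((a , y) ∷ []) + mass P? ([ e ]-1 *ᴳ ((a , y) ∷ [])) ∎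

    ∼-multiple : ∀ a z m → ((a , z +² ((+ m) ·² e)) ∷ []) ∼ ((a , z) ∷ [])
    ∼-multiple a z zero =
      ≡.subst (λ w → ((a , w) ∷ []) ∼ ((a , z) ∷ [])) (≡.sym (+²-zero-multiple z e)) ∼-refl
    ∼-multiple a z (suc m) =
      ≡.subst (λ w → ((a , w) ∷ []) ∼ ((a , z) ∷ [])) (+²-multiple-suc e z (+ m))
              (∼-trans (∼-step a _) (∼-multiple a z m))

    ∼-coset : ∀ a {z y} → Coset e z y → ((a , y) ∷ []) ∼ ((a , z) ∷ [])
    ∼-coset a {z} (+ m , ≡.refl) = ∼-multiple a z m
    ∼-coset a {z} (-[1+ m ] , ≡.refl) =
      ∼-sym (≡.subst (λ w → ((a , w) ∷ []) ∼ ((a , y) ∷ [])) (+²-multiple-cancel e z (+ suc m))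
                     (∼-multiple a y (suc m)))
      where
      y : ℤ²
      y = z +² (-[1+ m ] ·² e)

    decompose : ∀ y₀ h → Σ K λ c → h ∼ ((c , y₀) ∷ outside (coset? e y₀) h)
    decompose y₀ [] = 0# , ≋⇒∼ (same-masses λ P? → sym (same-mass (drop-zero-term y₀ [] refl) P?))
    decompose y₀ ((a , y) ∷ h) with coset? e y₀ y | decompose y₀ h
    ... | yes y∈ | c , h∼ = a + c , ∼-trans (∼-++ (∼-coset a y∈) h∼) (≋⇒∼ (merge-terms a c y₀ _))
    ... | no _   | c , h∼ = c , ∼-trans (∼-++ (∼-refl {(a , y) ∷ []}) h∼) (≋⇒∼ (swap-terms a y c y₀ _))

    criterion : ∀ n h → length h ℕ.≤ n → (∀ z → mass (coset? e z) h ≈ 0#) → h ∼ []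
    criterion _ [] _ _ = ∼-refl
    criterion (suc n) h@((a , y) ∷ h') (s≤s |h'|≤n) vanish =
      ∼-trans h∼ (∼-trans (≋⇒∼ (drop-zero-term y r γ≈0)) r∼[])
      where
      γ : K
      γ = proj₁ (decompose y h)
      r : Elem
      r = outside (coset? e y) h
      h∼ : h ∼ ((γ , y) ∷ r)
      h∼ = proj₂ (decompose y h)
      vanish′ : ∀ z → mass (coset? e z) ((γ , y) ∷ r) ≈ 0#
      vanish′ z = trans (sym (∼-invariant (coset? e z) (coset-invariant e z) h∼)) (vanish z)
      γ≈0 : γ ≈ 0#
      γ≈0 = begin
        γ                                                ≈⟨ when-yes (coset? e y y) γ (coset-refl e y) ⟨
        when (coset? e y y) γ                            ≈⟨ +-identityʳ _ ⟨
        when (coset? e y y) γ + 0#                       ≈⟨ +-congˡ (mass-disjoint (coset? e y) r (outside-∉ (coset? e y) h)) ⟨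
        mass (coset? e y) ((γ , y) ∷ r)                  ≈⟨ vanish′ y ⟩
        0#                                               ∎
      r∼[] : r ∼ []
      r∼[] = criterion n r (ℕP.≤-trans (outside-shorter (coset? e y) a y h' (coset-refl e y)) |h'|≤n)
               (λ z → trans (sym (same-mass (drop-zero-term y r γ≈0) (coset? e z))) (vanish′ z))

  -- This is the criterion for e = 0,
  -- whose cosets are single points: U - V has zero mass on every point, hence is ∼ 0 modulo
  -- ([0]-1) = 0, and every set is invariant under translation by 0.
  ≈ᴳ⇒≋ : ∀ {U V} → U ≈ᴳ V → U ≋ V
  ≈ᴳ⇒≋ {U} {V} U≈V = same-masses λ {P} P? → x∙y⁻¹≈ε⇒x≈y _ _ (begin
    mass P? U - mass P? V    ≈⟨ mass-difference P? U V ⟨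
    mass P? (U ++ -ᴳ V)      ≈⟨ ∼-invariant P? (invariant-0² P) (criterion _ (U ++ -ᴳ V) ℕP.≤-refl points) ⟩
    0#                       ∎)
    where
    open Boundaries 0²
    points : ∀ z → mass (coset? 0² z) (U ++ -ᴳ V) ≈ 0#
    points z = begin
      mass (coset? 0² z) (U ++ -ᴳ V)   ≈⟨ mass-ext _ (_≟² z) (coset-0² z) (U ++ -ᴳ V) ⟩
      mass (_≟² z) (U ++ -ᴳ V)         ≈⟨ mass-difference (_≟² z) U V ⟩
      mass (_≟² z) U - mass (_≟² z) V  ≈⟨ +-cong (coeff-as-mass U z) (-‿cong (coeff-as-mass V z)) ⟨
      coeff U z - coeff V z            ≈⟨ +-congʳ (U≈V z) ⟩
      coeff V z - coeff V z            ≈⟨ -‿inverseʳ _ ⟩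
      0#                               ∎

  periodic : ∀ d e a b q → (([ d ]-1 *ᴳ a) ++ -ᴳ ([ d ]-1 *ᴳ b)) ≈ᴳ ([ e ]-1 *ᴳ q) →
    ∀ {P} (P? : Decidable P) → Invariant e P →
    mass (λ y → P? (d +² y)) (a ++ -ᴳ b) ≈ mass P? (a ++ -ᴳ b)
  periodic d e a b q divisible {P} P? invariant = x∙y⁻¹≈ε⇒x≈y _ _ (begin
    mass P?d (a ++ -ᴳ b) - mass P? (a ++ -ᴳ b)
      ≈⟨ +-cong (mass-difference P?d a b) (-‿cong (mass-difference P? a b)) ⟩
    (mass P?d a - mass P?d b) - (mass P? a - mass P? b)
      ≈⟨ solve 4 (λ x y z w → ((x ⊕ (⊝ y)) ⊕ (⊝ (z ⊕ (⊝ w)))) ⊜ ((x ⊕ (⊝ z)) ⊕ (⊝ (y ⊕ (⊝ w))))) refl _ _ _ _ ⟩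
    (mass P?d a - mass P? a) - (mass P?d b - mass P? b)
      ≈⟨ +-cong (mass-boundary P? d a) (-‿cong (mass-boundary P? d b)) ⟨
    mass P? ([ d ]-1 *ᴳ a) - mass P? ([ d ]-1 *ᴳ b)
      ≈⟨ mass-difference P? ([ d ]-1 *ᴳ a) ([ d ]-1 *ᴳ b) ⟨
    mass P? (([ d ]-1 *ᴳ a) ++ -ᴳ ([ d ]-1 *ᴳ b))
      ≈⟨ same-mass (≈ᴳ⇒≋ {([ d ]-1 *ᴳ a) ++ -ᴳ ([ d ]-1 *ᴳ b)} {[ e ]-1 *ᴳ q} divisible) P? ⟩
    mass P? ([ e ]-1 *ᴳ q)
      ≈⟨ mass-boundary-invariant {e} P? invariant q ⟩
    0# ∎)
    where
    P?d : Decidable (λ y → P (d +² y))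
    P?d y = P? (d +² y)

  spread : ℤ² → ℤ² → Elem → ℕ
  spread e z [] = 0
  spread e z ((a , y) ∷ h) = ℤ.∣ det e z ℤ.- det e y ∣ ℕ.+ spread e z h

  far-translates-miss : ∀ e d z h N → det e d ≢ 0ℤ → spread e z h ℕ.< N →
    All (λ t → ¬ Coset e z (((+ N) ·² d) +² proj₂ t)) h
  far-translates-miss e d z [] N D≢0 _ = []
  far-translates-miss e d z ((a , y) ∷ h) N D≢0 small =
    escape e d z y N D≢0 (ℕP.≤-<-trans (ℕP.m≤m+n _ _) small) ∷
    far-translates-miss e d z h N D≢0 (ℕP.≤-<-trans (ℕP.m≤n+m _ _) small)

  -- Periodicity in a direction d transverse to e forces the mass on each coset z + ℤe to vanish:
  -- it equals the mass on the coset z - N·d + ℤe, which misses all terms of h for large N.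
  periodic⇒vanishing : ∀ d e → det e d ≢ 0ℤ → ∀ h →
    (∀ {P} (P? : Decidable P) → Invariant e P → mass (λ y → P? (d +² y)) h ≈ mass P? h) →
    ∀ z → mass (coset? e z) h ≈ 0#
  periodic⇒vanishing d e D≢0 h d-periodic z = begin
    mass (coset? e z) h                 ≈⟨ translated N ⟩
    mass (shifted N) h                  ≈⟨ mass-disjoint (shifted N) h (far-translates-miss e d z h N D≢0 ℕP.≤-refl) ⟩
    0#                                  ∎
    where
    N : ℕ
    N = suc (spread e z h)
    shifted : ∀ n → Decidable (λ y → Coset e z (((+ n) ·² d) +² y))
    shifted n y = coset? e z (((+ n) ·² d) +² y)
    translated : ∀ n → mass (coset? e z) h ≈ mass (shifted n) h
    translated zero = mass-ext (coset? e z) (shifted zero) (reindex (Coset e z) (λ y → ≡.sym (+²-identityˡ y))) h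
    translated (suc n) = trans (translated n) (sym (trans
      (mass-ext (shifted (suc n)) (λ y → shifted n (d +² y)) (reindex (Coset e z) (·²-suc-+² (+ n) d)) h)
      (d-periodic (shifted n) (invariant-translate {e} ((+ n) ·² d) (coset-invariant e z)))))

mainTheorem2 : {c ℓ : Level} (k : CommutativeRing c ℓ) →
    ¬ (CommutativeRing._≈_ k (CommutativeRing.1# k) (CommutativeRing.0# k)) →
    (d e : ℤ²) → d ≢ 0² → e ≢ 0² → LinearlyIndependent d e →
    WeaklyCoprime (GroupRing.k[ℤ²] k) (GroupRing.[_]-1 k d) (GroupRing.[_]-1 k e)
mainTheorem2 k _ d e _ e≢0 independent a b (q , divisible) =
  ∼⇒divisible (criterion (length h) h ℕP.≤-refl vanishing)
  where
  open CommutativeRing k using (_≈_; 0#)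
  open GroupRing k using (Elem; -ᴳ_)
  open GroupRingMasses k
  open Boundaries e
  h : Elem
  h = a ++ -ᴳ b
  vanishing : ∀ z → mass (coset? e z) h ≈ 0#
  vanishing = periodic⇒vanishing d e (independent⇒det≢0 d e e≢0 independent) h
                (periodic d e a b q divisible)
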